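{- Let $P,Q$ be posets with least elements and let $\langle f,g\rangle : P\times Q \to P\times Q$ be a monotone mapping (with $f:P\times Q\to P$, $g:P\times Q\to Q$; $P\times Q$ ordered componentwise). Let $m,n \geq 0$ be such that, for each $x\in P$, $\mu_{y}.g(x,y) = g_{x}^{m}(\bot)$ where $g_x(y)=g(x,y)$, and such that the function $h(x) = f(x,\mu_{y}.g(x,y))$ satisfies $\mu_{x}.h(x) = h^{n}(\bot)$. Then $\mu.\langle f,g\rangle = \langle f,g\rangle^{(n+1)(m+1)-1}(\bot,\bot)$. That is, $\mathrm{cl}(\langle f,g\rangle) \leq (\mathrm{cl}_y(g)+1)(\mathrm{cl}(h)+1)-1$.
   Context: For a monotone $k$ on a poset with least element $\bot$, $\mu.k$ denotes its least (pre)fixed point; the closure ordinal $\mathrm{cl}(k)$ is the least $n$ with $k^{n+1}(\bot)=k^n(\bot)$. $\mathrm{cl}_y(g)\le m$ means $\mathrm{cl}(g_x)\le m$ for every $x\in P$. -}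

module Defs where

open import Level using (Level; _⊔_)
open import Data.Nat using (ℕ; zero; suc)
open import Data.Product using (_×_; _,_)
open import Relation.Binary.Bundles using (Poset)
open import Data.Product.Relation.Binary.Pointwise.NonDependent using (×-poset)

private variable a b c ℓ₁ ℓ₂ : Level

iter : {A : Set a} → (A → A) → ℕ → A → A
iter k zero    x = x
iter k (suc n) x = k (iter k n x)

IsLeast : (P : Poset a ℓ₁ ℓ₂) → Poset.Carrier P → Set _
IsLeast P b = ∀ x → b ≤ x where open Poset P

Monotone : (P : Poset a ℓ₁ ℓ₂) → (Poset.Carrier P → Poset.Carrier P) → Set _
Monotone P k = ∀ {x y} → x ≤ y → k x ≤ k y where open Poset P

IsLfp : (P : Poset a ℓ₁ ℓ₂) → (Poset.Carrier P → Poset.Carrier P) → Poset.Carrier P → Set _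
IsLfp P k t = (k t ≤ t) × (∀ z → k z ≤ z → t ≤ z) where open Poset P

pairing : {A : Set a} {B : Set b} → (A × B → A) → (A × B → B) → A × B → A × B
pairing f g p = f p , g p

section : {A : Set a} {B : Set b} {C : Set c} → (A × B → C) → A → B → C
section g x y = g (x , y)

-- Write x̂ = μx.h(x) = hⁿ(⊥) and ŷ = g_{x̂}^m(⊥); then (x̂, ŷ) is a prefixed point of ⟨f,g⟩, so it
-- suffices to bound it by an iterate of ⟨f,g⟩. Each step of the h-chain costs m + 1 steps of the
-- ⟨f,g⟩-chain (m to iterate g_x up to g_x^m(⊥), one more to apply f), so hʲ(⊥) is dominated after
-- j(m+1) steps, and m further steps bring ŷ under the second component: m + n(m+1) in total.
module Submission where

open import Defs
open import Level using (Level)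
open import Data.Nat using (ℕ; _+_; _*_; _∸_; zero; suc)
open import Data.Nat.Properties using (+-comm)
open import Data.Product using (_×_; _,_; proj₁; proj₂)
open import Relation.Binary.Bundles using (Poset)
open import Data.Product.Relation.Binary.Pointwise.NonDependent using (×-poset)
open import Relation.Binary.PropositionalEquality using (_≡_; cong; cong₂; subst; sym)

module KleeneIterates {a ℓ₁ ℓ₂ : Level} (P : Poset a ℓ₁ ℓ₂)
  {⊥ : Poset.Carrier P} (⊥-least : IsLeast P ⊥)
  {k : Poset.Carrier P → Poset.Carrier P} (k-mono : Monotone P k) where

  open Poset P

  iter-≤-prefixed : ∀ {t} → k t ≤ t → ∀ j → iter k j ⊥ ≤ t
  iter-≤-prefixed {t} _   zero    = ⊥-least t
  iter-≤-prefixed     pre (suc j) = trans (k-mono (iter-≤-prefixed pre j)) pre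

  iter-≤-iter-suc : ∀ j → iter k j ⊥ ≤ iter k (suc j) ⊥
  iter-≤-iter-suc zero    = ⊥-least (k ⊥)
  iter-≤-iter-suc (suc j) = k-mono (iter-≤-iter-suc j)

  iter-isLfp : ∀ {t} j → k t ≤ t → t ≤ iter k j ⊥ → IsLfp P k (iter k j ⊥)
  iter-isLfp j pre t≤kʲ⊥ =
    trans (k-mono (iter-≤-prefixed pre j)) (trans pre t≤kʲ⊥) ,
    λ z z-pre → iter-≤-prefixed z-pre j

open KleeneIterates using (iter-≤-iter-suc; iter-isLfp)

module PairingIterates {a ℓ₁ ℓ₂ b ℓ₃ ℓ₄ : Level} (P : Poset a ℓ₁ ℓ₂) (Q : Poset b ℓ₃ ℓ₄)
  {⊥P : Poset.Carrier P} {⊥Q : Poset.Carrier Q}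
  (⊥P-least : IsLeast P ⊥P) (⊥Q-least : IsLeast Q ⊥Q)
  (f : Poset.Carrier P × Poset.Carrier Q → Poset.Carrier P)
  (g : Poset.Carrier P × Poset.Carrier Q → Poset.Carrier Q)
  (fg-mono : Monotone (×-poset P Q) (pairing f g)) where

  open Poset (×-poset P Q) using (_≤_)

  ⊥-least : IsLeast (×-poset P Q) (⊥P , ⊥Q)
  ⊥-least (x , y) = ⊥P-least x , ⊥Q-least y

  orbit : ℕ → Poset.Carrier P × Poset.Carrier Q
  orbit j = iter (pairing f g) j (⊥P , ⊥Q)

  approx : ℕ → Poset.Carrier P → Poset.Carrier Q
  approx m x = iter (section g x) m ⊥Q

  reduced : ℕ → Poset.Carrier P → Poset.Carrier P
  reduced m x = f (x , approx m x)

  approx-≤-orbit : ∀ {x k} → (x , ⊥Q) ≤ orbit k → ∀ i → (x , approx i x) ≤ orbit (i + k)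
  approx-≤-orbit x⊥≤ zero    = x⊥≤
  approx-≤-orbit {x} {k} x⊥≤ (suc i) =
    proj₁ (trans IH (iter-≤-iter-suc (×-poset P Q) ⊥-least fg-mono (i + k))) ,
    proj₂ (fg-mono IH)
    where
      open Poset (×-poset P Q) using (trans)
      IH : (x , approx i x) ≤ orbit (i + k)
      IH = approx-≤-orbit x⊥≤ i

  reduced-iter-≤-orbit : ∀ m j → (iter (reduced m) j ⊥P , ⊥Q) ≤ orbit (j * suc m)
  reduced-iter-≤-orbit m zero    = ⊥-least (⊥P , ⊥Q)
  reduced-iter-≤-orbit m (suc j) =
    proj₁ (fg-mono (approx-≤-orbit (reduced-iter-≤-orbit m j) m)) , ⊥Q-least _

iterationCount : ∀ m n → (n + 1) * (m + 1) ∸ 1 ≡ m + n * suc m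
iterationCount m n = cong (_∸ 1) (cong₂ _*_ (+-comm n 1) (+-comm m 1))

proposition6p3 : ∀ {a ℓ₁ ℓ₂ b ℓ₃ ℓ₄ : Level} (P : Poset a ℓ₁ ℓ₂) (Q : Poset b ℓ₃ ℓ₄)
    (⊥P : Poset.Carrier P) (⊥Q : Poset.Carrier Q) → IsLeast P ⊥P → IsLeast Q ⊥Q →
    (f : Poset.Carrier P × Poset.Carrier Q → Poset.Carrier P)
    (g : Poset.Carrier P × Poset.Carrier Q → Poset.Carrier Q) →
    Monotone (×-poset P Q) (pairing f g) →
    (m n : ℕ) →
    (∀ x → IsLfp Q (section g x) (iter (section g x) m ⊥Q)) →
    IsLfp P (λ x → f (x , iter (section g x) m ⊥Q))
      (iter (λ x → f (x , iter (section g x) m ⊥Q)) n ⊥P) →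
    IsLfp (×-poset P Q) (pairing f g)
      (iter (pairing f g) ((n + 1) * (m + 1) ∸ 1) (⊥P , ⊥Q))
proposition6p3 P Q ⊥P ⊥Q ⊥P-least ⊥Q-least f g fg-mono m n g-lfp h-lfp =
  subst (λ N → IsLfp (×-poset P Q) (pairing f g) (orbit N)) (sym (iterationCount m n))
    (iter-isLfp (×-poset P Q) ⊥-least fg-mono (m + n * suc m) prefixed bounded)
  where
    open PairingIterates P Q ⊥P-least ⊥Q-least f g fg-mono
    open Poset (×-poset P Q) using (_≤_)
    x̂ : Poset.Carrier P
    x̂ = iter (reduced m) n ⊥P
    prefixed : pairing f g (x̂ , approx m x̂) ≤ (x̂ , approx m x̂)
    prefixed = proj₁ h-lfp , proj₁ (g-lfp x̂)
    bounded : (x̂ , approx m x̂) ≤ orbit (m + n * suc m)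
    bounded = approx-≤-orbit (reduced-iter-≤-orbit m n) m
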